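{- Let $N$ be a positive integer with $\sigma^{**}(N)=3N$, and let $e,f$ be the exponents with $2^e\,\|\,N$ and $3^f\,\|\,N$. Then it is impossible that $e\ge 7$ and $f=4$.
   Context: $\sigma^{**}(N)$ is the sum of the biunitary divisors of $N$, where a divisor $d$ of $N$ is biunitary if the greatest common unitary divisor of $d$ and $N/d$ is $1$ (a divisor $d$ of $m$ being unitary if $\gcd(d,m/d)=1$). $p^a\,\|\,N$ means $p^a\mid N$ and $p^{a+1}\nmid N$. -}

module Defs where

open import Data.Nat using (ℕ; zero; suc; _+_; _*_; _^_; _≡ᵇ_; NonZero)
open import Data.Nat.Base using (_/_)
open import Data.Nat.Divisibility using (_∣_; _∣?_)
open import Data.Nat.GCD using (gcd)
open import Data.List using (List; filter; upTo; foldr; map)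
open import Data.Nat.ListAction using (sum)
open import Data.Bool using (Bool; true; false; _∧_; if_then_else_)
open import Relation.Nullary.Decidable using (⌊_⌋)
open import Data.Nat.Properties using (_≟_)
open import Data.Nat using (_⊔_)

divisors : ℕ → List ℕ
divisors n = filter (λ d → d ∣? n) (map suc (upTo n))

isUnitaryDivisor : ℕ → ℕ → Bool
isUnitaryDivisor zero    m = false
isUnitaryDivisor (suc k) m =
  ⌊ suc k ∣? m ⌋ ∧ (gcd (suc k) (m / suc k) ≡ᵇ 1)

gcud : ℕ → ℕ → ℕ
gcud a b = foldr _⊔_ 0
  (filter (λ d → isUnitaryDivisor d b Data.Bool.≟ true)
    (filter (λ d → isUnitaryDivisor d a Data.Bool.≟ true) (divisors a)))

isBiunitaryDivisor : ℕ → ℕ → Bool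
isBiunitaryDivisor zero    N = false
isBiunitaryDivisor (suc k) N =
  ⌊ suc k ∣? N ⌋ ∧ (gcud (suc k) (N / suc k) ≡ᵇ 1)

σ** : ℕ → ℕ
σ** N = sum (filter (λ d → isBiunitaryDivisor d N Data.Bool.≟ true) (divisors N))

open import Relation.Nullary using (¬_)
open import Data.Product using (_×_)
_^_∥_ : ℕ → ℕ → ℕ → Set
p ^ a ∥ N = (p ^ a ∣ N) × ¬ (p ^ suc a ∣ N)

-- σ** is multiplicative, and p^i is a biunitary divisor of p^a exactly when 2i ≠ a.
-- If σ**(N) = 3N then σ**(u) ≤ 3u for every unitary divisor u of N (u ∣ N with
-- gcd(u, N/u) = 1), because σ**(N/u) ≥ N/u. For e ≥ 7 we have σ**(2^e) ≥ (61/32)·2^e,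
-- and σ**(3^4) = 112; as 7 ∣ 112 ∣ 3N, also 7 ∣ N. If 7^h ∥ N with h ≠ 2 then
-- σ**(7^h) ≥ (8/7)·7^h, so the unitary divisor u = 2^e·3^4·7^h would have
-- σ**(u)/u ≥ (61·112·8)/(32·81·7) > 3; hence 7^2 ∥ N. In the same way σ**(7^2) = 50
-- gives 5^2 ∥ N, and σ**(5^2) = 26 gives 13^2 ∥ N. Finally 5^3 divides
-- σ**(7^2·13^2) = 50·170, which divides 3N, contradicting 5^2 ∥ N.

module Submission where

open import Defs
open import Data.Bool using (Bool; true; false; _∧_; if_then_else_)
import Data.Bool as Bool
open import Data.Bool.Properties using (T-≡; ⇔→≡; ∧-conicalˡ)
open import Data.Empty using (⊥-elim)
open import Data.List using (List; []; _∷_; _++_; map; filter; upTo; cartesianProductWith)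
open import Data.List.Membership.Propositional using (_∈_)
open import Data.List.Membership.Propositional.Properties
open import Data.List.Membership.Propositional.Properties.WithK using (unique∧set⇒bag)
open import Data.List.Properties using (foldr-forcesᵇ; foldr-preservesᵇ; map-++)
open import Data.List.Relation.Binary.BagAndSetEquality using (∼bag⇒↭)
open import Data.List.Relation.Binary.Permutation.Propositional using (_↭_)
import Data.List.Relation.Binary.Permutation.Propositional.Properties as Perm
open import Data.List.Relation.Unary.All as All using (All; []; _∷_)
import Data.List.Relation.Unary.All.Properties as All
import Data.List.Relation.Unary.AllPairs as AllPairs
open import Data.List.Relation.Unary.AllPairs using ([]; _∷_)
open import Data.List.Relation.Unary.Any using (here; there)
open import Data.List.Relation.Unary.Linked using ([-]; _∷_)
open import Data.List.Relation.Unary.Linked.Properties using (Linked⇒AllPairs)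
open import Data.List.Relation.Unary.Unique.Propositional using (Unique)
import Data.List.Relation.Unary.Unique.Propositional.Properties as Unique
open import Data.Nat
open import Data.Nat.Coprimality as Coprime
  using (Coprime; coprime?; coprime-divisor; coprime⇒gcd≡1; gcd≡1⇒coprime; coprime-/gcd)
open import Data.Nat.Divisibility
open import Data.Nat.DivMod using (m*n/n≡m; m*[n/m]≡n)
open import Data.Nat.GCD using (gcd; gcd[m,n]∣m; gcd[m,n]∣n; gcd-greatest)
open import Data.Nat.ListAction using (sum)
open import Data.Nat.ListAction.Properties using (sum-++; sum-↭)
open import Data.Nat.Primality using (Prime; prime⇒irreducible; prime⇒nonTrivial; euclidsLemma; prime[2]; prime?)
open import Data.Nat.Properties
open import Algebra.Properties.CommutativeSemigroup *-commutativeSemigroup using (x∙yz≈y∙xz)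
open import Data.Nat.Solver using (module +-*-Solver)
open +-*-Solver using (solve; _:+_; _:*_; _:=_; con)
open import Data.Product as Product using (∃-syntax; _×_; _,_; proj₁; proj₂)
open import Data.Sum using (_⊎_; inj₁; inj₂)
open import Function using (_∘_)
open import Function.Bundles using (_⇔_; mk⇔; Equivalence)
open import Relation.Binary.Definitions using (tri<; tri≈; tri>)
open import Relation.Binary.PropositionalEquality
open import Relation.Nullary using (¬_; yes; no)
open import Relation.Nullary.Decidable using (⌊_⌋; dec-true; isYes≗does; toWitness; from-yes; from-no)
open import Relation.Unary using (Decidable)

private
  variable
    a b c c′ d d′ d₁ d₂ e₁ e₂ k m n p q u v : ℕ

coprime-∣ˡ : Coprime a b → c ∣ a → Coprime c b
coprime-∣ˡ a⊥b c∣a (d∣c , d∣b) = a⊥b (∣-trans d∣c c∣a , d∣b)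

coprime-∣ʳ : Coprime a b → c ∣ b → Coprime a c
coprime-∣ʳ a⊥b c∣b (d∣a , d∣c) = a⊥b (d∣a , ∣-trans d∣c c∣b)

coprime-*ˡ : Coprime a c → Coprime b c → Coprime (a * b) c
coprime-*ˡ a⊥c b⊥c (d∣ab , d∣c) =
  b⊥c (coprime-divisor (Coprime.sym (coprime-∣ʳ a⊥c d∣c)) d∣ab , d∣c)

coprime-*ʳ : Coprime a b → Coprime a c → Coprime a (b * c)
coprime-*ʳ a⊥b a⊥c = Coprime.sym (coprime-*ˡ (Coprime.sym a⊥b) (Coprime.sym a⊥c))

prime∤⇒coprime : Prime p → ¬ p ∣ m → Coprime p m
prime∤⇒coprime p-prime p∤m (d∣p , d∣m) with prime⇒irreducible p-prime d∣p
... | inj₁ d≡1 = d≡1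
... | inj₂ refl = ⊥-elim (p∤m d∣m)

coprime-^ˡ : ∀ k → Prime p → ¬ p ∣ m → Coprime (p ^ k) m
coprime-^ˡ zero    p-prime p∤m (d∣1 , _) = ∣1⇒≡1 d∣1
coprime-^ˡ (suc k) p-prime p∤m = coprime-*ˡ (prime∤⇒coprime p-prime p∤m) (coprime-^ˡ k p-prime p∤m)

prime∤* : Prime p → ¬ p ∣ m → ¬ p ∣ n → ¬ p ∣ m * n
prime∤* {m = m} {n} p-prime p∤m p∤n p∣mn with euclidsLemma m n p-prime p∣mn
... | inj₁ p∣m = p∤m p∣m
... | inj₂ p∣n = p∤n p∣n

prime∤^ : ∀ k → Prime p → ¬ p ∣ m → ¬ p ∣ m ^ k
prime∤^ zero    p-prime p∤m p∣1 = nonTrivial⇒≢1 {{prime⇒nonTrivial p-prime}} (∣1⇒≡1 p∣1)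
prime∤^ (suc k) p-prime p∤m = prime∤* p-prime p∤m (prime∤^ k p-prime p∤m)

∣-positive : n > 0 → d ∣ n → d > 0
∣-positive n>0 d∣n = n≢0⇒n>0 λ { refl → >⇒≢ n>0 (0∣⇒≡0 d∣n) }

factor-positive : n > 0 → n ≡ a * b → a > 0 × b > 0
factor-positive {a = a} {b} n>0 refl = ∣-positive n>0 (m∣m*n b) , ∣-positive n>0 (n∣m*n a)

∈-divisors⁻ : d ∈ divisors n → d ∣ n
∈-divisors⁻ {n = n} d∈ = proj₂ (∈-filter⁻ (_∣? n) {xs = map suc (upTo n)} d∈)

∈-divisors⁺ : n > 0 → d ∣ n → d ∈ divisors n
∈-divisors⁺ {n} {zero}  n>0 0∣n = ⊥-elim (>⇒≢ n>0 (0∣⇒≡0 0∣n))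
∈-divisors⁺ {n} {suc k} n>0 d∣n =
  ∈-filter⁺ (_∣? n) (∈-map⁺ suc (∈-upTo⁺ (∣⇒≤ {{>-nonZero n>0}} d∣n))) d∣n

divisors-unique : ∀ n → Unique (divisors n)
divisors-unique n = Unique.filter⁺ (_∣? n) (Unique.map⁺ suc-injective (Unique.upTo⁺ n))

UnitaryDivisor : ℕ → ℕ → Set
UnitaryDivisor u m = ∃[ v ] m ≡ u * v × Coprime u v

UnitarilyCoprime : ℕ → ℕ → Set
UnitarilyCoprime a b = ∀ u → UnitaryDivisor u a → UnitaryDivisor u b → u ≡ 1

≡ᵇ-true⇔ : (m ≡ᵇ n) ≡ true ⇔ m ≡ n
≡ᵇ-true⇔ {m} {n} = mk⇔ (λ eq → ≡ᵇ⇒≡ m n (Equivalence.from T-≡ eq))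
                        (λ eq → Equivalence.to T-≡ (≡⇒≡ᵇ m n eq))

m*n/m≡n : ∀ m n .{{_ : NonZero m}} → m * n / m ≡ n
m*n/m≡n m n = trans (cong (_/ m) (*-comm m n)) (m*n/n≡m n m)

∣?∧-quotient : ∀ (P : ℕ → Bool) → m ≡ suc k * q → (⌊ suc k ∣? m ⌋ ∧ P (m / suc k)) ≡ P q
∣?∧-quotient {k = k} {q} P refl =
  cong₂ _∧_ (trans (isYes≗does (suc k ∣? _)) (dec-true (suc k ∣? _) (m∣m*n q)))
            (cong P (m*n/m≡n (suc k) q))

isUnitaryDivisor-quotient : m > 0 → m ≡ u * q → isUnitaryDivisor u m ≡ (gcd u q ≡ᵇ 1)
isUnitaryDivisor-quotient {u = zero}  () refl
isUnitaryDivisor-quotient {u = suc k} _  m≡ = ∣?∧-quotient (λ q → gcd (suc k) q ≡ᵇ 1) m≡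

isBiunitaryDivisor-quotient : m > 0 → m ≡ d * q → isBiunitaryDivisor d m ≡ (gcud d q ≡ᵇ 1)
isBiunitaryDivisor-quotient {d = zero}  () refl
isBiunitaryDivisor-quotient {d = suc k} _  m≡ = ∣?∧-quotient (λ q → gcud (suc k) q ≡ᵇ 1) m≡

isUnitaryDivisor⇔ : m > 0 → isUnitaryDivisor u m ≡ true ⇔ UnitaryDivisor u m
isUnitaryDivisor⇔ {m} {u} m>0 = mk⇔ (to u) from
  where
  to : ∀ u → isUnitaryDivisor u m ≡ true → UnitaryDivisor u m
  to zero    ()
  to (suc k) eq = quotient u∣m , m≡ ,
    gcd≡1⇒coprime (Equivalence.to ≡ᵇ-true⇔ (trans (sym (isUnitaryDivisor-quotient m>0 m≡)) eq))
    where
    u∣m : suc k ∣ m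
    u∣m = toWitness (Equivalence.from T-≡ (∧-conicalˡ ⌊ suc k ∣? m ⌋ _ eq))
    m≡ : m ≡ suc k * quotient u∣m
    m≡ = m∣n⇒n≡m*quotient u∣m
  from : UnitaryDivisor u m → isUnitaryDivisor u m ≡ true
  from (v , m≡ , u⊥v) =
    trans (isUnitaryDivisor-quotient {u = u} m>0 m≡) (Equivalence.from ≡ᵇ-true⇔ (coprime⇒gcd≡1 u⊥v))

unitaryDivisor-1 : ∀ m → UnitaryDivisor 1 m
unitaryDivisor-1 m = m , sym (*-identityˡ m) , λ (d∣1 , _) → ∣1⇒≡1 d∣1

unitaryDivisor-∣ : UnitaryDivisor u m → u ∣ m
unitaryDivisor-∣ (v , refl , _) = m∣m*n v

commonUnitaryDivisors : ℕ → ℕ → List ℕ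
commonUnitaryDivisors a b = filter (λ d → isUnitaryDivisor d b Bool.≟ true)
  (filter (λ d → isUnitaryDivisor d a Bool.≟ true) (divisors a))

∈-commonUnitaryDivisors⁻ : a > 0 → b > 0 → u ∈ commonUnitaryDivisors a b →
                           UnitaryDivisor u a × UnitaryDivisor u b
∈-commonUnitaryDivisors⁻ {a} {b} a>0 b>0 u∈ =
  let u∈′ , isUDb = ∈-filter⁻ (λ d → isUnitaryDivisor d b Bool.≟ true) u∈
      _   , isUDa = ∈-filter⁻ (λ d → isUnitaryDivisor d a Bool.≟ true) {xs = divisors a} u∈′
  in Equivalence.to (isUnitaryDivisor⇔ a>0) isUDa , Equivalence.to (isUnitaryDivisor⇔ b>0) isUDb

∈-commonUnitaryDivisors⁺ : a > 0 → b > 0 → UnitaryDivisor u a → UnitaryDivisor u b →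
                           u ∈ commonUnitaryDivisors a b
∈-commonUnitaryDivisors⁺ {a} {b} a>0 b>0 uA uB =
  ∈-filter⁺ (λ d → isUnitaryDivisor d b Bool.≟ true)
    (∈-filter⁺ (λ d → isUnitaryDivisor d a Bool.≟ true)
      (∈-divisors⁺ a>0 (unitaryDivisor-∣ uA)) (Equivalence.from (isUnitaryDivisor⇔ a>0) uA))
    (Equivalence.from (isUnitaryDivisor⇔ b>0) uB)

gcud≡1⇔ : a > 0 → b > 0 → gcud a b ≡ 1 ⇔ UnitarilyCoprime a b
gcud≡1⇔ {a} {b} a>0 b>0 = mk⇔ to from
  where
  all≤gcud : All (_≤ gcud a b) (commonUnitaryDivisors a b)
  all≤gcud = foldr-forcesᵇ (λ x y x⊔y≤ → m⊔n≤o⇒m≤o x y x⊔y≤ , m⊔n≤o⇒n≤o x y x⊔y≤) 0 _ ≤-refl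
  1≤gcud : 1 ≤ gcud a b
  1≤gcud = All.lookup all≤gcud (∈-commonUnitaryDivisors⁺ a>0 b>0 (unitaryDivisor-1 a) (unitaryDivisor-1 b))
  to : gcud a b ≡ 1 → UnitarilyCoprime a b
  to gcud≡1 _ uA uB = ≤-antisym
    (subst (_ ≤_) gcud≡1 (All.lookup all≤gcud (∈-commonUnitaryDivisors⁺ a>0 b>0 uA uB)))
    (∣-positive a>0 (unitaryDivisor-∣ uA))
  from : UnitarilyCoprime a b → gcud a b ≡ 1
  from coprime = ≤-antisym (foldr-preservesᵇ ⊔-lub z≤n (All.tabulate λ u∈ →
                   let uA , uB = ∈-commonUnitaryDivisors⁻ a>0 b>0 u∈ in ≤-reflexive (coprime _ uA uB)))
                 1≤gcud

unitaryDivisor-*ʳ : UnitaryDivisor u a → Coprime u b → UnitaryDivisor u (a * b)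
unitaryDivisor-*ʳ {u} {b = b} (v , refl , u⊥v) u⊥b = v * b , *-assoc u v b , coprime-*ʳ u⊥v u⊥b

unitaryDivisor-gcd : a > 0 → UnitaryDivisor u (a * b) → UnitaryDivisor (gcd u a) a
unitaryDivisor-gcd {a} {u} {b} a>0 (v , ab≡uv , u⊥v) = a / g , sym a≡gw , g⊥w
  where
  g : ℕ
  g = gcd u a
  instance
    g≢0 : NonZero g
    g≢0 = >-nonZero (∣-positive a>0 (gcd[m,n]∣n u a))
  a≡gw : g * (a / g) ≡ a
  a≡gw = m*[n/m]≡n (gcd[m,n]∣n u a)
  u≡gu′ : g * (u / g) ≡ u
  u≡gu′ = m*[n/m]≡n (gcd[m,n]∣m u a)
  wb≡u′v : a / g * b ≡ u / g * v
  wb≡u′v = *-cancelˡ-≡ _ _ g (begin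
    g * (a / g * b)   ≡⟨ *-assoc g (a / g) b ⟨
    g * (a / g) * b   ≡⟨ cong (_* b) a≡gw ⟩
    a * b             ≡⟨ ab≡uv ⟩
    u * v             ≡⟨ cong (_* v) u≡gu′ ⟨
    g * (u / g) * v   ≡⟨ *-assoc g (u / g) v ⟩
    g * (u / g * v)   ∎)
    where open ≡-Reasoning
  w∣v : a / g ∣ v
  w∣v = coprime-divisor (Coprime.sym (coprime-/gcd u a)) (divides b (trans (sym wb≡u′v) (*-comm (a / g) b)))
  g⊥w : Coprime g (a / g)
  g⊥w (i∣g , i∣w) = u⊥v (∣-trans i∣g (gcd[m,n]∣m u a) , ∣-trans i∣w w∣v)

gcd-∣-coprime-factor : Coprime a d → u ∣ c * d → gcd u a ∣ c
gcd-∣-coprime-factor {a} {d} {u} {c} a⊥d u∣cd =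
  coprime-divisor (Coprime.sym (coprime-∣ʳ (Coprime.sym a⊥d) (gcd[m,n]∣n u a)))
    (∣-trans (gcd[m,n]∣m u a) (subst (u ∣_) (*-comm c d) u∣cd))

module _ {d₁ e₁ d₂ e₂ : ℕ} (coprime : Coprime (d₁ * e₁) (d₂ * e₂)) where

  private
    d₁⊥d₂ : Coprime d₁ d₂
    d₁⊥d₂ = coprime-∣ʳ (coprime-∣ˡ coprime (m∣m*n e₁)) (m∣m*n e₂)
    d₁⊥e₂ : Coprime d₁ e₂
    d₁⊥e₂ = coprime-∣ʳ (coprime-∣ˡ coprime (m∣m*n e₁)) (n∣m*n d₂)
    e₁⊥d₂ : Coprime e₁ d₂
    e₁⊥d₂ = coprime-∣ʳ (coprime-∣ˡ coprime (n∣m*n d₁)) (m∣m*n e₂)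
    e₁⊥e₂ : Coprime e₁ e₂
    e₁⊥e₂ = coprime-∣ʳ (coprime-∣ˡ coprime (n∣m*n d₁)) (n∣m*n d₂)

  unitarilyCoprime-*⇒ˡ : UnitarilyCoprime (d₁ * d₂) (e₁ * e₂) → UnitarilyCoprime d₁ e₁
  unitarilyCoprime-*⇒ˡ uc u uD uE = uc u
    (unitaryDivisor-*ʳ uD (coprime-∣ˡ d₁⊥d₂ (unitaryDivisor-∣ uD)))
    (unitaryDivisor-*ʳ uE (coprime-∣ˡ e₁⊥e₂ (unitaryDivisor-∣ uE)))

  -- gcd u d₁ = gcd u e₁ is a unitary divisor of both d₁ and e₁
  unitarilyCoprime⇒gcd≡1 : d₁ > 0 → e₁ > 0 → UnitaryDivisor u (d₁ * d₂) → UnitaryDivisor u (e₁ * e₂) →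
                           UnitarilyCoprime d₁ e₁ → gcd u d₁ ≡ 1
  unitarilyCoprime⇒gcd≡1 {u} d₁>0 e₁>0 uD uE uc = uc _ (unitaryDivisor-gcd d₁>0 uD)
    (subst (λ g → UnitaryDivisor g e₁) (sym gcd-agree) (unitaryDivisor-gcd e₁>0 uE))
    where
    gcd-agree : gcd u d₁ ≡ gcd u e₁
    gcd-agree = ∣-antisym
      (gcd-greatest (gcd[m,n]∣m u d₁) (gcd-∣-coprime-factor d₁⊥e₂ (unitaryDivisor-∣ uE)))
      (gcd-greatest (gcd[m,n]∣m u e₁) (gcd-∣-coprime-factor e₁⊥d₂ (unitaryDivisor-∣ uD)))

unitarilyCoprime-*⇔ : d₁ > 0 → e₁ > 0 → d₂ > 0 → e₂ > 0 → Coprime (d₁ * e₁) (d₂ * e₂) →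
                      UnitarilyCoprime (d₁ * d₂) (e₁ * e₂) ⇔
                      (UnitarilyCoprime d₁ e₁ × UnitarilyCoprime d₂ e₂)
unitarilyCoprime-*⇔ {d₁} {e₁} {d₂} {e₂} d₁>0 e₁>0 d₂>0 e₂>0 coprime = mk⇔
  (λ uc → unitarilyCoprime-*⇒ˡ coprime uc ,
          unitarilyCoprime-*⇒ˡ coprime′ (subst₂ UnitarilyCoprime (*-comm d₁ d₂) (*-comm e₁ e₂) uc))
  from
  where
  coprime′ : Coprime (d₂ * e₂) (d₁ * e₁)
  coprime′ = Coprime.sym coprime
  from : UnitarilyCoprime d₁ e₁ × UnitarilyCoprime d₂ e₂ → UnitarilyCoprime (d₁ * d₂) (e₁ * e₂)
  from (uc₁ , uc₂) u uD uE = ∣1⇒≡1 (subst (u ∣_) gcd[u,d₂]≡1 (gcd-greatest ∣-refl u∣d₂))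
    where
    gcd[u,d₁]≡1 : gcd u d₁ ≡ 1
    gcd[u,d₁]≡1 = unitarilyCoprime⇒gcd≡1 coprime d₁>0 e₁>0 uD uE uc₁
    gcd[u,d₂]≡1 : gcd u d₂ ≡ 1
    gcd[u,d₂]≡1 = unitarilyCoprime⇒gcd≡1 coprime′ d₂>0 e₂>0
      (subst (UnitaryDivisor u) (*-comm d₁ d₂) uD) (subst (UnitaryDivisor u) (*-comm e₁ e₂) uE) uc₂
    u∣d₂ : u ∣ d₂
    u∣d₂ = coprime-divisor (gcd≡1⇒coprime gcd[u,d₁]≡1) (unitaryDivisor-∣ uD)

∧-≡true⇔ : ∀ {x y} → (x ∧ y) ≡ true ⇔ (x ≡ true × y ≡ true)
∧-≡true⇔ {true}  = mk⇔ (refl ,_) proj₂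
∧-≡true⇔ {false} = mk⇔ (λ ()) λ ()

isBiunitaryDivisor⇔ : n > 0 → n ≡ d * q → isBiunitaryDivisor d n ≡ true ⇔ UnitarilyCoprime d q
isBiunitaryDivisor⇔ {n} {d} {q} n>0 n≡dq = mk⇔
  (λ isBU → Equivalence.to gcud⇔ (Equivalence.to ≡ᵇ-true⇔ (trans (sym quotient-form) isBU)))
  (λ uc → trans quotient-form (Equivalence.from ≡ᵇ-true⇔ (Equivalence.from gcud⇔ uc)))
  where
  quotient-form : isBiunitaryDivisor d n ≡ (gcud d q ≡ᵇ 1)
  quotient-form = isBiunitaryDivisor-quotient {d = d} n>0 n≡dq
  gcud⇔ : gcud d q ≡ 1 ⇔ UnitarilyCoprime d q
  gcud⇔ = gcud≡1⇔ (proj₁ (factor-positive {a = d} n>0 n≡dq)) (proj₂ (factor-positive {a = d} n>0 n≡dq))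

isBiunitaryDivisor-* : a > 0 → b > 0 → Coprime a b → c ∣ a → d ∣ b →
  isBiunitaryDivisor (c * d) (a * b) ≡ isBiunitaryDivisor c a ∧ isBiunitaryDivisor d b
isBiunitaryDivisor-* {a} {b} {c} {d} a>0 b>0 a⊥b c∣a d∣b = ⇔→≡ (mk⇔
  (λ isBU → Equivalence.from ∧-≡true⇔
     (Product.map (Equivalence.from c-BU) (Equivalence.from d-BU)
       (Equivalence.to split (Equivalence.to cd-BU isBU))))
  (λ both → Equivalence.from cd-BU (Equivalence.from split
     (Product.map (Equivalence.to c-BU) (Equivalence.to d-BU) (Equivalence.to ∧-≡true⇔ both)))))
  where
  e f : ℕ
  e = quotient c∣a
  f = quotient d∣b
  a≡ce : a ≡ c * e
  a≡ce = m∣n⇒n≡m*quotient c∣a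
  b≡df : b ≡ d * f
  b≡df = m∣n⇒n≡m*quotient d∣b
  c>0,e>0 : c > 0 × e > 0
  c>0,e>0 = factor-positive {a = c} a>0 a≡ce
  d>0,f>0 : d > 0 × f > 0
  d>0,f>0 = factor-positive {a = d} b>0 b≡df
  c-BU : isBiunitaryDivisor c a ≡ true ⇔ UnitarilyCoprime c e
  c-BU = isBiunitaryDivisor⇔ {d = c} a>0 a≡ce
  d-BU : isBiunitaryDivisor d b ≡ true ⇔ UnitarilyCoprime d f
  d-BU = isBiunitaryDivisor⇔ {d = d} b>0 b≡df
  cd-BU : isBiunitaryDivisor (c * d) (a * b) ≡ true ⇔ UnitarilyCoprime (c * d) (e * f)
  cd-BU = isBiunitaryDivisor⇔ {d = c * d} (*-mono-< a>0 b>0)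
            (trans (cong₂ _*_ a≡ce b≡df) ([m*n]*[o*p]≡[m*o]*[n*p] c e d f))
  split : UnitarilyCoprime (c * d) (e * f) ⇔ (UnitarilyCoprime c e × UnitarilyCoprime d f)
  split = unitarilyCoprime-*⇔ (proj₁ c>0,e>0) (proj₂ c>0,e>0) (proj₁ d>0,f>0) (proj₂ d>0,f>0)
            (subst₂ Coprime a≡ce b≡df a⊥b)

module _ {A B : Set} (f : A → B) where

  map-unique : ∀ {xs} → (∀ {x y} → x ∈ xs → y ∈ xs → f x ≡ f y → x ≡ y) →
               Unique xs → Unique (map f xs)
  map-unique         inj []          = []
  map-unique {x ∷ _} inj (x∉ ∷ xs!) =
    All.map⁺ (All.tabulate λ y∈ fx≡fy → All.lookup x∉ y∈ (inj (here refl) (there y∈) fx≡fy))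
    ∷ map-unique (λ x∈ y∈ → inj (there x∈) (there y∈)) xs!

module _ {A B C : Set} (_∙_ : A → B → C) where

  cartesianProductWith-unique : ∀ {xs ys} →
    (∀ {w x y z} → w ∈ xs → x ∈ xs → y ∈ ys → z ∈ ys → w ∙ y ≡ x ∙ z → w ≡ x × y ≡ z) →
    Unique xs → Unique ys → Unique (cartesianProductWith _∙_ xs ys)
  cartesianProductWith-unique {[]}          inj _          _   = []
  cartesianProductWith-unique {x ∷ xs} {ys} inj (x∉ ∷ xs!) ys! = Unique.++⁺
    (map-unique (x ∙_) (λ y∈ z∈ → proj₂ ∘ inj (here refl) (here refl) y∈ z∈) ys!)
    (cartesianProductWith-unique (λ w∈ x∈ → inj (there w∈) (there x∈)) xs! ys!)
    disjoint
    where
    disjoint : ∀ {v} → ¬ (v ∈ map (x ∙_) ys × v ∈ cartesianProductWith _∙_ xs ys)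
    disjoint (v∈row , v∈rest) with ∈-map⁻ (x ∙_) v∈row | ∈-cartesianProductWith⁻ _∙_ xs ys v∈rest
    ... | y , y∈ , refl | w , z , w∈ , z∈ , xy≡wz =
      All.lookup x∉ w∈ (proj₁ (inj (here refl) (there w∈) y∈ z∈ xy≡wz))

  sum-map-cartesianProductWith : ∀ (h : C → ℕ) (f : A → ℕ) (g : B → ℕ) xs ys →
    (∀ {x y} → x ∈ xs → y ∈ ys → h (x ∙ y) ≡ f x * g y) →
    sum (map h (cartesianProductWith _∙_ xs ys)) ≡ sum (map f xs) * sum (map g ys)
  sum-map-cartesianProductWith h f g []       ys h≡ = refl
  sum-map-cartesianProductWith h f g (x ∷ xs) ys h≡ = begin
    sum (map h (map (x ∙_) ys ++ cartesianProductWith _∙_ xs ys))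
      ≡⟨ cong sum (map-++ h (map (x ∙_) ys) _) ⟩
    sum (map h (map (x ∙_) ys) ++ map h (cartesianProductWith _∙_ xs ys))
      ≡⟨ sum-++ (map h (map (x ∙_) ys)) _ ⟩
    sum (map h (map (x ∙_) ys)) + sum (map h (cartesianProductWith _∙_ xs ys))
      ≡⟨ cong₂ _+_ (row ys (h≡ (here refl))) (sum-map-cartesianProductWith h f g xs ys (h≡ ∘ there)) ⟩
    f x * sum (map g ys) + sum (map f xs) * sum (map g ys)
      ≡⟨ *-distribʳ-+ (sum (map g ys)) (f x) _ ⟨
    sum (map f (x ∷ xs)) * sum (map g ys) ∎
    where
    open ≡-Reasoning
    row : ∀ zs → (∀ {y} → y ∈ zs → h (x ∙ y) ≡ f x * g y) →
          sum (map h (map (x ∙_) zs)) ≡ f x * sum (map g zs)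
    row []       _   = sym (*-zeroʳ (f x))
    row (z ∷ zs) h≡′ = trans (cong₂ _+_ (h≡′ (here refl)) (row zs (h≡′ ∘ there)))
                             (sym (*-distribˡ-+ (f x) (g z) _))

divisor-of-*-split : a > 0 → c ∣ a * b → ∃[ c₁ ] ∃[ c₂ ] c ≡ c₁ * c₂ × c₁ ∣ a × c₂ ∣ b
divisor-of-*-split {a} {c} {b} a>0 c∣ab = g , c / g , sym c≡gc′ , gcd[m,n]∣n c a , c′∣b
  where
  g : ℕ
  g = gcd c a
  instance
    g≢0 : NonZero g
    g≢0 = >-nonZero (∣-positive a>0 (gcd[m,n]∣n c a))
  c≡gc′ : g * (c / g) ≡ c
  c≡gc′ = m*[n/m]≡n (gcd[m,n]∣m c a)
  a≡ga′ : g * (a / g) ≡ a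
  a≡ga′ = m*[n/m]≡n (gcd[m,n]∣n c a)
  c′∣b : c / g ∣ b
  c′∣b = coprime-divisor (coprime-/gcd c a) (*-cancelˡ-∣ g
           (subst₂ _∣_ (sym c≡gc′) (trans (cong (_* b) (sym a≡ga′)) (*-assoc g (a / g) b)) c∣ab))

coprime-divisors-*-injective : Coprime a b → c ∣ a → c′ ∣ a → d ∣ b → d′ ∣ b → c > 0 →
                               c * d ≡ c′ * d′ → c ≡ c′ × d ≡ d′
coprime-divisors-*-injective {c = c} {c′} {d} {d′} a⊥b c∣a c′∣a d∣b d′∣b c>0 cd≡c′d′ =
  c≡c′ , *-cancelˡ-≡ d d′ c {{>-nonZero c>0}} (trans cd≡c′d′ (cong (_* d′) (sym c≡c′)))
  where
  c≡c′ : c ≡ c′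
  c≡c′ = ∣-antisym
    (coprime-divisor (coprime-∣ʳ (coprime-∣ˡ a⊥b c∣a) d′∣b)
      (subst (c ∣_) (trans cd≡c′d′ (*-comm c′ d′)) (m∣m*n d)))
    (coprime-divisor (coprime-∣ʳ (coprime-∣ˡ a⊥b c′∣a) d∣b)
      (subst (c′ ∣_) (trans (sym cd≡c′d′) (*-comm c d)) (m∣m*n d′)))

divisors-*-↭ : a > 0 → b > 0 → Coprime a b →
               divisors (a * b) ↭ cartesianProductWith _*_ (divisors a) (divisors b)
divisors-*-↭ {a} {b} a>0 b>0 a⊥b = ∼bag⇒↭ (unique∧set⇒bag (divisors-unique (a * b))
  (cartesianProductWith-unique _*_ injective (divisors-unique a) (divisors-unique b))
  (mk⇔ to from))
  where
  injective : ∀ {c c′ d d′} → c ∈ divisors a → c′ ∈ divisors a → d ∈ divisors b → d′ ∈ divisors b →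
              c * d ≡ c′ * d′ → c ≡ c′ × d ≡ d′
  injective c∈ c′∈ d∈ d′∈ = coprime-divisors-*-injective a⊥b c∣a (∈-divisors⁻ {n = a} c′∈)
    (∈-divisors⁻ {n = b} d∈) (∈-divisors⁻ {n = b} d′∈) (∣-positive a>0 c∣a)
    where c∣a = ∈-divisors⁻ {n = a} c∈
  to : ∀ {c} → c ∈ divisors (a * b) → c ∈ cartesianProductWith _*_ (divisors a) (divisors b)
  to c∈ with divisor-of-*-split a>0 (∈-divisors⁻ c∈)
  ... | c₁ , c₂ , refl , c₁∣a , c₂∣b =
    ∈-cartesianProductWith⁺ _*_ (∈-divisors⁺ a>0 c₁∣a) (∈-divisors⁺ b>0 c₂∣b)
  from : ∀ {c} → c ∈ cartesianProductWith _*_ (divisors a) (divisors b) → c ∈ divisors (a * b)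
  from c∈ with ∈-cartesianProductWith⁻ _*_ (divisors a) (divisors b) c∈
  ... | c₁ , c₂ , c₁∈ , c₂∈ , refl =
    ∈-divisors⁺ (*-mono-< a>0 b>0) (*-pres-∣ (∈-divisors⁻ {n = a} c₁∈) (∈-divisors⁻ {n = b} c₂∈))

biunitaryPart : ℕ → ℕ → ℕ
biunitaryPart n d = if isBiunitaryDivisor d n then d else 0

sum-filter-isBiunitaryDivisor : ∀ n xs →
  sum (filter (λ d → isBiunitaryDivisor d n Bool.≟ true) xs) ≡ sum (map (biunitaryPart n) xs)
sum-filter-isBiunitaryDivisor n []       = refl
sum-filter-isBiunitaryDivisor n (x ∷ xs) with isBiunitaryDivisor x n
... | true  = cong (x +_) (sum-filter-isBiunitaryDivisor n xs)
... | false = sum-filter-isBiunitaryDivisor n xs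

if-∧-* : ∀ x y c d → (if x ∧ y then c * d else 0) ≡ (if x then c else 0) * (if y then d else 0)
if-∧-* true  true  c d = refl
if-∧-* true  false c d = sym (*-zeroʳ c)
if-∧-* false _     c d = refl

biunitaryPart-* : a > 0 → b > 0 → Coprime a b → c ∣ a → d ∣ b →
                  biunitaryPart (a * b) (c * d) ≡ biunitaryPart a c * biunitaryPart b d
biunitaryPart-* {a} {b} {c} {d} a>0 b>0 a⊥b c∣a d∣b =
  trans (cong (λ β → if β then c * d else 0) (isBiunitaryDivisor-* a>0 b>0 a⊥b c∣a d∣b))
        (if-∧-* (isBiunitaryDivisor c a) (isBiunitaryDivisor d b) c d)

σ**-* : a > 0 → b > 0 → Coprime a b → σ** (a * b) ≡ σ** a * σ** b
σ**-* {a} {b} a>0 b>0 a⊥b = begin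
  σ** (a * b)
    ≡⟨ sum-filter-isBiunitaryDivisor (a * b) (divisors (a * b)) ⟩
  sum (map (biunitaryPart (a * b)) (divisors (a * b)))
    ≡⟨ sum-↭ (Perm.map⁺ (biunitaryPart (a * b)) (divisors-*-↭ a>0 b>0 a⊥b)) ⟩
  sum (map (biunitaryPart (a * b)) (cartesianProductWith _*_ (divisors a) (divisors b)))
    ≡⟨ sum-map-cartesianProductWith _*_ (biunitaryPart (a * b)) (biunitaryPart a) (biunitaryPart b) _ _
         (λ c∈ d∈ → biunitaryPart-* a>0 b>0 a⊥b (∈-divisors⁻ {n = a} c∈) (∈-divisors⁻ {n = b} d∈)) ⟩
  sum (map (biunitaryPart a) (divisors a)) * sum (map (biunitaryPart b) (divisors b))
    ≡⟨ cong₂ _*_ (sum-filter-isBiunitaryDivisor a (divisors a))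
                 (sum-filter-isBiunitaryDivisor b (divisors b)) ⟨
  σ** a * σ** b ∎
  where open ≡-Reasoning

sum-⊆-≤ : ∀ {xs ys} → Unique xs → (∀ {x} → x ∈ xs → x ∈ ys) → sum xs ≤ sum ys
sum-⊆-≤ {[]}     _           _ = z≤n
sum-⊆-≤ {x ∷ xs} (x∉ ∷ xs!) ⊆ with ∈-∃++ (⊆ (here refl))
... | as , bs , refl = begin
  x + sum xs          ≤⟨ +-monoʳ-≤ x (sum-⊆-≤ xs! ⊆′) ⟩
  x + sum (as ++ bs)  ≡⟨ sum-↭ (Perm.shift x as bs) ⟨
  sum (as ++ x ∷ bs)  ∎
  where
  open ≤-Reasoning
  ⊆′ : ∀ {y} → y ∈ xs → y ∈ as ++ bs
  ⊆′ y∈ with Perm.∈-resp-↭ (Perm.shift x as bs) (⊆ (there y∈))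
  ... | here refl = ⊥-elim (All.lookup x∉ y∈ refl)
  ... | there y∈′ = y∈′

BiunitaryDivisor : ℕ → ℕ → Set
BiunitaryDivisor d n = ∃[ q ] n ≡ d * q × UnitarilyCoprime d q

sum-≤-σ** : ∀ {ds} → n > 0 → Unique ds → (∀ {d} → d ∈ ds → BiunitaryDivisor d n) →
            sum ds ≤ σ** n
sum-≤-σ** {n} n>0 ds! biunitary = sum-⊆-≤ ds! λ {d} d∈ →
  let q , n≡dq , uc = biunitary d∈ in
  ∈-filter⁺ (λ d → isBiunitaryDivisor d n Bool.≟ true)
    (∈-divisors⁺ n>0 (subst (d ∣_) (sym n≡dq) (m∣m*n q)))
    (Equivalence.from (isBiunitaryDivisor⇔ {d = d} n>0 n≡dq) uc)

n≤σ**n : n > 0 → n ≤ σ** n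
n≤σ**n {n} n>0 = subst (_≤ σ** n) (+-identityʳ n) (sum-≤-σ** n>0 ([] ∷ []) λ { (here refl) →
  1 , sym (*-identityʳ n) , λ u _ u∥1 → ∣1⇒≡1 (unitaryDivisor-∣ u∥1) })

^-injectiveʳ : ∀ {i j} → 1 < p → p ^ i ≡ p ^ j → i ≡ j
^-injectiveʳ {p} {i} {j} p>1 eq with <-cmp i j
... | tri< i<j _ _ = ⊥-elim (<⇒≢ (^-monoʳ-< p p>1 i<j) eq)
... | tri≈ _ i≡j _ = i≡j
... | tri> _ _ j<i = ⊥-elim (>⇒≢ (^-monoʳ-< p p>1 j<i) eq)

unitaryDivisor-prime-power : Prime p → UnitaryDivisor u (p ^ k) → u ≡ 1 ⊎ u ≡ p ^ k
unitaryDivisor-prime-power {p} {u} {k} p-prime (v , p^k≡uv , u⊥v) with p ∣? u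
... | no  p∤u = inj₁ (coprime-^ˡ k p-prime p∤u (subst (u ∣_) (sym p^k≡uv) (m∣m*n v) , ∣-refl))
... | yes p∣u = inj₂ (begin
  u      ≡⟨ *-identityʳ u ⟨
  u * 1  ≡⟨ cong (u *_) v≡1 ⟨
  u * v  ≡⟨ p^k≡uv ⟨
  p ^ k  ∎)
  where
  open ≡-Reasoning
  p∤v : ¬ p ∣ v
  p∤v p∣v = nonTrivial⇒≢1 {{prime⇒nonTrivial p-prime}} (u⊥v (p∣u , p∣v))
  v≡1 : v ≡ 1
  v≡1 = coprime-^ˡ k p-prime p∤v (subst (v ∣_) (sym p^k≡uv) (n∣m*n u) , ∣-refl)

-- j + i rather than i + j: then 2 ^ (1 + (8 + k)) is definitionally 2 ^ (9 + k)
prime-power-biunitaryDivisor : ∀ {i j} → Prime p → i ≢ j → BiunitaryDivisor (p ^ i) (p ^ (j + i))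
prime-power-biunitaryDivisor {p} {i} {j} p-prime i≢j =
  p ^ j , trans (^-distribˡ-+-* p j i) (*-comm (p ^ j) (p ^ i)) , unitarilyCoprime
  where
  unitarilyCoprime : UnitarilyCoprime (p ^ i) (p ^ j)
  unitarilyCoprime u u∥p^i u∥p^j
    with unitaryDivisor-prime-power {k = i} p-prime u∥p^i | unitaryDivisor-prime-power {k = j} p-prime u∥p^j
  ... | inj₁ u≡1 | _        = u≡1
  ... | inj₂ _   | inj₁ u≡1 = u≡1
  ... | inj₂ u≡  | inj₂ u≡′ =
    ⊥-elim (i≢j (^-injectiveʳ (nonTrivial⇒n>1 p {{prime⇒nonTrivial p-prime}}) (trans (sym u≡) u≡′)))

-- σ**(n)/n ≥ a/b, cross-multiplied to stay in ℕ
record AbundancyAtLeast (a b n : ℕ) : Set where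
  constructor abundancy-bound
  field
    cross-multiplied : a * n ≤ b * σ** n

abundancy-σ** : ∀ n → AbundancyAtLeast (σ** n) n n
abundancy-σ** n = abundancy-bound (≤-reflexive (*-comm (σ** n) n))

abundancy-* : m > 0 → n > 0 → Coprime m n → AbundancyAtLeast a b m → AbundancyAtLeast c d n →
              AbundancyAtLeast (a * c) (b * d) (m * n)
abundancy-* {m} {n} {a} {b} {c} {d} m>0 n>0 m⊥n (abundancy-bound am≤bσm) (abundancy-bound cn≤dσn) =
  abundancy-bound (begin
  a * c * (m * n)          ≡⟨ [m*n]*[o*p]≡[m*o]*[n*p] a c m n ⟩
  a * m * (c * n)          ≤⟨ *-mono-≤ am≤bσm cn≤dσn ⟩
  b * σ** m * (d * σ** n)  ≡⟨ [m*n]*[o*p]≡[m*o]*[n*p] b (σ** m) d (σ** n) ⟩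
  b * d * (σ** m * σ** n)  ≡⟨ cong (b * d *_) (σ**-* m>0 n>0 m⊥n) ⟨
  b * d * σ** (m * n)      ∎)
  where open ≤-Reasoning

abundancy-prime-power : ∀ {h} → Prime p → h ≢ 1 → AbundancyAtLeast (1 + p) p (p ^ suc h)
abundancy-prime-power {p} {h} p-prime h≢1 = abundancy-bound (begin
  (1 + p) * p ^ suc h               ≡⟨ solve 2 (λ p x → (con 1 :+ p) :* (p :* x) := p :* (p :* x :+ (x :+ con 0)))
                                               refl p (p ^ h) ⟩
  p * sum (p ^ suc h ∷ p ^ h ∷ [])  ≤⟨ *-monoʳ-≤ p (sum-≤-σ** p^[1+h]>0 distinct biunitary) ⟩
  p * σ** (p ^ suc h)               ∎)
  where
  open ≤-Reasoning
  p>1 : 1 < p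
  p>1 = nonTrivial⇒n>1 p {{prime⇒nonTrivial p-prime}}
  p^h<p^[1+h] : p ^ h < p ^ suc h
  p^h<p^[1+h] = ^-monoʳ-< p p>1 (n<1+n h)
  p^[1+h]>0 : p ^ suc h > 0
  p^[1+h]>0 = ≤-<-trans z≤n p^h<p^[1+h]
  distinct : Unique (p ^ suc h ∷ p ^ h ∷ [])
  distinct = (>⇒≢ p^h<p^[1+h] ∷ []) ∷ [] ∷ []
  biunitary : ∀ {d} → d ∈ p ^ suc h ∷ p ^ h ∷ [] → BiunitaryDivisor d (p ^ suc h)
  biunitary (here refl)         = prime-power-biunitaryDivisor {i = suc h} {j = 0} p-prime λ ()
  biunitary (there (here refl)) = prime-power-biunitaryDivisor {j = 1} p-prime h≢1

31*2^[5+k]≤σ**[2^[9+k]] : ∀ k → 31 * 2 ^ (5 + k) ≤ σ** (2 ^ (9 + k))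
31*2^[5+k]≤σ**[2^[9+k]] k = begin
  31 * 2 ^ (5 + k)  ≡⟨ solve 1 (λ x → con 31 :* x :=
                          con 2 :* (con 2 :* (con 2 :* (con 2 :* x))) :+ (con 2 :* (con 2 :* (con 2 :* x))
                          :+ (con 2 :* (con 2 :* x) :+ (con 2 :* x :+ (x :+ con 0))))) refl (2 ^ (5 + k)) ⟩
  sum top-five      ≤⟨ sum-≤-σ** (m^n>0 2 (9 + k)) distinct biunitary ⟩
  σ** (2 ^ (9 + k)) ∎
  where
  open ≤-Reasoning
  top-five : List ℕ
  top-five = 2 ^ (9 + k) ∷ 2 ^ (8 + k) ∷ 2 ^ (7 + k) ∷ 2 ^ (6 + k) ∷ 2 ^ (5 + k) ∷ []
  2^n<2^[1+n] : ∀ n → 2 ^ n < 2 ^ suc n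
  2^n<2^[1+n] n = ^-monoʳ-< 2 (s≤s (s≤s z≤n)) (n<1+n n)
  distinct : Unique top-five
  distinct = AllPairs.map >⇒≢ (Linked⇒AllPairs (λ x>y y>z → <-trans y>z x>y)
    (2^n<2^[1+n] (8 + k) ∷ 2^n<2^[1+n] (7 + k) ∷ 2^n<2^[1+n] (6 + k) ∷ 2^n<2^[1+n] (5 + k) ∷ [-]))
  2^-biunitary : ∀ i j → i ≢ j → BiunitaryDivisor (2 ^ i) (2 ^ (j + i))
  2^-biunitary i j = prime-power-biunitaryDivisor {i = i} {j} prime[2]
  biunitary : ∀ {d} → d ∈ top-five → BiunitaryDivisor d (2 ^ (9 + k))
  biunitary (here refl)                                 = 2^-biunitary (9 + k) 0 λ ()
  biunitary (there (here refl))                         = 2^-biunitary (8 + k) 1 λ ()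
  biunitary (there (there (here refl)))                 = 2^-biunitary (7 + k) 2 λ ()
  biunitary (there (there (there (here refl))))         = 2^-biunitary (6 + k) 3 λ ()
  biunitary (there (there (there (there (here refl))))) = 2^-biunitary (5 + k) 4 λ ()

abundancy-2^ : ∀ {e} → 7 ≤ e → AbundancyAtLeast 61 32 (2 ^ e)
abundancy-2^ {e} 7≤e = subst (AbundancyAtLeast 61 32 ∘ (2 ^_)) (m+[n∸m]≡n 7≤e) (from-7 (e ∸ 7))
  where
  -- e = 7, 8 by evaluation: for e = 8 the divisor 2^4 is not biunitary
  from-7 : ∀ k → AbundancyAtLeast 61 32 (2 ^ (7 + k))
  from-7 0             = abundancy-bound (≤ᵇ⇒≤ _ _ _)
  from-7 1             = abundancy-bound (≤ᵇ⇒≤ _ _ _)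
  from-7 (suc (suc k)) = abundancy-bound (begin
    61 * 2 ^ (9 + k)         ≡⟨ solve 1 (λ x → con 61 :* (con 2 :* (con 2 :* (con 2 :* (con 2 :* x))))
                                             := con 976 :* x) refl (2 ^ (5 + k)) ⟩
    976 * 2 ^ (5 + k)        ≤⟨ *-monoˡ-≤ (2 ^ (5 + k)) (≤ᵇ⇒≤ 976 992 _) ⟩
    32 * 31 * 2 ^ (5 + k)    ≡⟨ *-assoc 32 31 (2 ^ (5 + k)) ⟩
    32 * (31 * 2 ^ (5 + k))  ≤⟨ *-monoʳ-≤ 32 (31*2^[5+k]≤σ**[2^[9+k]] k) ⟩
    32 * σ** (2 ^ (9 + k))   ∎)
    where open ≤-Reasoning

unitaryDivisor-∥ : Prime p → p ^ k ∥ n → UnitaryDivisor (p ^ k) n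
unitaryDivisor-∥ {p} {k} {n} p-prime (p^k∣n , p^[1+k]∤n) =
  quotient p^k∣n , n≡ , coprime-^ˡ k p-prime p∤q
  where
  n≡ : n ≡ p ^ k * quotient p^k∣n
  n≡ = m∣n⇒n≡m*quotient p^k∣n
  p∤q : ¬ p ∣ quotient p^k∣n
  p∤q p∣q = p^[1+k]∤n (subst₂ _∣_ (*-comm (p ^ k) p) (sym n≡) (*-monoʳ-∣ (p ^ k) p∣q))

coprime-unitaryDivisors-* : n > 0 → UnitaryDivisor a n → UnitaryDivisor b n → Coprime a b →
                            UnitaryDivisor (a * b) n
coprime-unitaryDivisors-* {n} {a} {b} n>0 (y , n≡ay , a⊥y) (w , n≡bw , b⊥w) a⊥b =
  t , trans n≡ay (trans (cong (a *_) y≡bt) (sym (*-assoc a b t))) , coprime-*ˡ a⊥t b⊥t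
  where
  b∣y : b ∣ y
  b∣y = coprime-divisor (Coprime.sym a⊥b) (subst (b ∣_) n≡ay (subst (b ∣_) (sym n≡bw) (m∣m*n w)))
  t : ℕ
  t = quotient b∣y
  y≡bt : y ≡ b * t
  y≡bt = m∣n⇒n≡m*quotient b∣y
  a⊥t : Coprime a t
  a⊥t = coprime-∣ʳ a⊥y (subst (t ∣_) (sym y≡bt) (n∣m*n b))
  w≡at : w ≡ a * t
  w≡at = *-cancelˡ-≡ w (a * t) b {{>-nonZero (proj₁ (factor-positive {a = b} n>0 n≡bw))}} (begin
    b * w        ≡⟨ n≡bw ⟨
    n            ≡⟨ n≡ay ⟩
    a * y        ≡⟨ cong (a *_) y≡bt ⟩
    a * (b * t)  ≡⟨ x∙yz≈y∙xz a b t ⟩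
    b * (a * t)  ∎)
    where open ≡-Reasoning
  b⊥t : Coprime b t
  b⊥t = coprime-∣ʳ b⊥w (subst (t ∣_) (sym w≡at) (n∣m*n a))

∃-boundary : ∀ {P : ℕ → Set} → Decidable P → P 0 → ¬ P n → ∃[ a ] P a × ¬ P (suc a)
∃-boundary {zero}  P? P0 ¬P0 = ⊥-elim (¬P0 P0)
∃-boundary {suc n} P? P0 ¬P[1+n] with P? n
... | yes Pn  = n , Pn , ¬P[1+n]
... | no  ¬Pn = ∃-boundary P? P0 ¬Pn

n<p^n : 1 < p → ∀ n → n < p ^ n
n<p^n     p>1 zero    = s≤s z≤n
n<p^n {p} p>1 (suc n) = ≤-<-trans (n<p^n p>1 n) (^-monoʳ-< p p>1 (n<1+n n))

exact-power : Prime p → n > 0 → p ∣ n → ∃[ h ] p ^ suc h ∥ n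
exact-power {p} {n} p-prime n>0 p∣n = exponent (∃-boundary {n = n} (λ a → p ^ a ∣? n) (1∣ n) p^n∤n)
  where
  p^n∤n : ¬ p ^ n ∣ n
  p^n∤n p^n∣n =
    <⇒≱ (n<p^n (nonTrivial⇒n>1 p {{prime⇒nonTrivial p-prime}}) n) (∣⇒≤ {{>-nonZero n>0}} p^n∣n)
  exponent : ∃[ a ] p ^ a ∣ n × ¬ p ^ suc a ∣ n → ∃[ h ] p ^ suc h ∥ n
  exponent (zero  , _ , p∤n) = ⊥-elim (p∤n (subst (_∣ n) (sym (*-identityʳ p)) p∣n))
  exponent (suc h , p^[1+h]∥n) = h , p^[1+h]∥n

module MultiplyPerfect (r : ℕ) {N : ℕ} (N>0 : N > 0) (perfect : σ** N ≡ r * N) where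

  record UnitaryDivisorWithAbundancy (a b u : ℕ) : Set where
    constructor _,_
    field
      unitaryDivisor : UnitaryDivisor u N
      abundancy      : AbundancyAtLeast a b u

  private
    σ**-cofactor : ((v , _ , _) : UnitaryDivisor u N) → σ** u * σ** v ≡ r * N
    σ**-cofactor {u} (v , N≡uv , u⊥v) = begin
      σ** u * σ** v  ≡⟨ σ**-* u>0 v>0 u⊥v ⟨
      σ** (u * v)    ≡⟨ cong σ** N≡uv ⟨
      σ** N          ≡⟨ perfect ⟩
      r * N          ∎
      where
      open ≡-Reasoning
      u>0 : u > 0
      u>0 = proj₁ (factor-positive {a = u} N>0 N≡uv)
      v>0 : v > 0
      v>0 = proj₂ (factor-positive {a = u} N>0 N≡uv)

  coprime-∣σ**⇒∣ : Coprime m r → UnitaryDivisor u N → m ∣ σ** u → m ∣ N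
  coprime-∣σ**⇒∣ {u = u} m⊥r u∥N@(v , _) m∣σ**u =
    coprime-divisor m⊥r (∣-trans m∣σ**u (subst (σ** u ∣_) (σ**-cofactor u∥N) (m∣m*n (σ** v))))

  σ**-unitaryDivisor-≤ : UnitaryDivisor u N → σ** u ≤ r * u
  σ**-unitaryDivisor-≤ {u} u∥N@(v , N≡uv , _) = *-cancelʳ-≤ (σ** u) (r * u) v {{>-nonZero v>0}} (begin
    σ** u * v      ≤⟨ *-monoʳ-≤ (σ** u) (n≤σ**n v>0) ⟩
    σ** u * σ** v  ≡⟨ σ**-cofactor u∥N ⟩
    r * N          ≡⟨ cong (r *_) N≡uv ⟩
    r * (u * v)    ≡⟨ *-assoc r u v ⟨
    r * u * v      ∎)
    where
    open ≤-Reasoning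
    v>0 : v > 0
    v>0 = proj₂ (factor-positive {a = u} N>0 N≡uv)

  abundancy-≤ : UnitaryDivisorWithAbundancy a b u → a ≤ r * b
  abundancy-≤ {a} {b} {u} (u∥N , abundancy-bound au≤bσu) = *-cancelʳ-≤ a (r * b) u {{>-nonZero u>0}} (begin
    a * u          ≤⟨ au≤bσu ⟩
    b * σ** u      ≤⟨ *-monoʳ-≤ b (σ**-unitaryDivisor-≤ u∥N) ⟩
    b * (r * u)    ≡⟨ x∙yz≈y∙xz b r u ⟩
    r * (b * u)    ≡⟨ *-assoc r b u ⟨
    r * b * u      ∎)
    where
    open ≤-Reasoning
    u>0 : u > 0
    u>0 = ∣-positive N>0 (unitaryDivisor-∣ u∥N)

  withAbundancy-* : Coprime u v → UnitaryDivisorWithAbundancy a b u → UnitaryDivisorWithAbundancy c d v →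
                    UnitaryDivisorWithAbundancy (a * c) (b * d) (u * v)
  withAbundancy-* {a = a} {b} {c} {d} u⊥v (u∥N , u-abundancy) (v∥N , v-abundancy) =
    coprime-unitaryDivisors-* N>0 u∥N v∥N u⊥v ,
    abundancy-* {a = a} {b} {c} {d} (∣-positive N>0 (unitaryDivisor-∣ u∥N)) (∣-positive N>0 (unitaryDivisor-∣ v∥N))
      u⊥v u-abundancy v-abundancy

  extend-by-prime-power : ∀ {q} → Prime q → ¬ q ∣ u → UnitaryDivisorWithAbundancy a b u →
                          q ^ k ∥ N → AbundancyAtLeast c d (q ^ k) →
                          UnitaryDivisorWithAbundancy (a * c) (b * d) (u * q ^ k)
  extend-by-prime-power {k = k} {q = q} q-prime q∤u u-bound q^k∥N q^k-abundancy =
    withAbundancy-* (Coprime.sym (coprime-^ˡ k q-prime q∤u)) u-bound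
      (unitaryDivisor-∥ {p = q} {k} q-prime q^k∥N , q^k-abundancy)

  exponent-two : ∀ {q} → Prime q → ¬ q ∣ u → UnitaryDivisorWithAbundancy a b u →
                 r * (b * q) < a * (1 + q) → q ∣ N → q ^ 2 ∥ N
  exponent-two {q = q} q-prime q∤u u-bound too-abundant q∣N with exact-power q-prime N>0 q∣N
  ... | h , q^[1+h]∥N with h ≟ 1
  ...   | yes refl = q^[1+h]∥N
  ...   | no  h≢1  = ⊥-elim (<⇒≱ too-abundant (abundancy-≤
    (extend-by-prime-power {k = suc h} q-prime q∤u u-bound q^[1+h]∥N (abundancy-prime-power {p = q} {h} q-prime h≢1))))

module Lemma3p5 {N e : ℕ} (N>0 : N > 0) (perfect : σ** N ≡ 3 * N)
                (2^e∥N : 2 ^ e ∥ N) (3⁴∥N : 3 ^ 4 ∥ N) (7≤e : 7 ≤ e) where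

  open MultiplyPerfect 3 N>0 perfect

  private
    prime3 : Prime 3
    prime3 = from-yes (prime? 3)
    prime5 : Prime 5
    prime5 = from-yes (prime? 5)
    prime7 : Prime 7
    prime7 = from-yes (prime? 7)
    prime13 : Prime 13
    prime13 = from-yes (prime? 13)

  u₀ : UnitaryDivisorWithAbundancy (61 * 112) (32 * 81) (2 ^ e * 3 ^ 4)
  u₀ = withAbundancy-* (coprime-^ˡ e prime[2] (from-no (2 ∣? 81)))
         (unitaryDivisor-∥ {k = e} prime[2] 2^e∥N , abundancy-2^ 7≤e)
         (unitaryDivisor-∥ {k = 4} prime3 3⁴∥N , abundancy-σ** 81)

  7∤u₀ : ¬ 7 ∣ 2 ^ e * 3 ^ 4
  7∤u₀ = prime∤* prime7 (prime∤^ e prime7 (from-no (7 ∣? 2))) (from-no (7 ∣? 81))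

  7²∥N : 7 ^ 2 ∥ N
  7²∥N = exponent-two prime7 7∤u₀ u₀ (≤ᵇ⇒≤ (1 + 3 * (32 * 81 * 7)) (61 * 112 * 8) _)
           (coprime-∣σ**⇒∣ (from-yes (coprime? 7 3)) (unitaryDivisor-∥ {k = 4} prime3 3⁴∥N) (from-yes (7 ∣? 112)))

  u₁ : UnitaryDivisorWithAbundancy (61 * 112 * 50) (32 * 81 * 49) (2 ^ e * 3 ^ 4 * 7 ^ 2)
  u₁ = extend-by-prime-power {k = 2} prime7 7∤u₀ u₀ 7²∥N (abundancy-σ** 49)

  5∤u₁ : ¬ 5 ∣ 2 ^ e * 3 ^ 4 * 7 ^ 2
  5∤u₁ = prime∤* prime5 (prime∤* prime5 (prime∤^ e prime5 (from-no (5 ∣? 2))) (from-no (5 ∣? 81)))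
           (from-no (5 ∣? 49))

  5²∥N : 5 ^ 2 ∥ N
  5²∥N = exponent-two prime5 5∤u₁ u₁ (≤ᵇ⇒≤ (1 + 3 * (32 * 81 * 49 * 5)) (61 * 112 * 50 * 6) _)
           (coprime-∣σ**⇒∣ (from-yes (coprime? 5 3)) (unitaryDivisor-∥ {k = 2} prime7 7²∥N) (from-yes (5 ∣? 50)))

  u₂ : UnitaryDivisorWithAbundancy (61 * 112 * 50 * 26) (32 * 81 * 49 * 25) (2 ^ e * 3 ^ 4 * 7 ^ 2 * 5 ^ 2)
  u₂ = extend-by-prime-power {k = 2} prime5 5∤u₁ u₁ 5²∥N (abundancy-σ** 25)

  13∤u₂ : ¬ 13 ∣ 2 ^ e * 3 ^ 4 * 7 ^ 2 * 5 ^ 2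
  13∤u₂ = prime∤* prime13 (prime∤* prime13 (prime∤* prime13 (prime∤^ e prime13 (from-no (13 ∣? 2)))
            (from-no (13 ∣? 81))) (from-no (13 ∣? 49))) (from-no (13 ∣? 25))

  13²∥N : 13 ^ 2 ∥ N
  13²∥N = exponent-two prime13 13∤u₂ u₂ (≤ᵇ⇒≤ (1 + 3 * (32 * 81 * 49 * 25 * 13)) (61 * 112 * 50 * 26 * 14) _)
            (coprime-∣σ**⇒∣ (from-yes (coprime? 13 3)) (unitaryDivisor-∥ {k = 2} prime5 5²∥N) (from-yes (13 ∣? 26)))

  -- the explicit 7 ^ 2 * 13 ^ 2 stops the checker from normalising it to 8281 and evaluating σ** 8281
  5³∣N : 5 ^ 3 ∣ N
  5³∣N = coprime-∣σ**⇒∣ {m = 5 ^ 3} {u = 7 ^ 2 * 13 ^ 2} (from-yes (coprime? 125 3))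
           (coprime-unitaryDivisors-* {a = 7 ^ 2} {b = 13 ^ 2} N>0
             (unitaryDivisor-∥ {k = 2} prime7 7²∥N) (unitaryDivisor-∥ {k = 2} prime13 13²∥N) 7²⊥13²)
           (subst (5 ^ 3 ∣_) (sym (σ**-* {a = 7 ^ 2} {b = 13 ^ 2} (s≤s z≤n) (s≤s z≤n) 7²⊥13²))
             (from-yes (125 ∣? 8500)))
    where
    7²⊥13² : Coprime (7 ^ 2) (13 ^ 2)
    7²⊥13² = from-yes (coprime? 49 169)

lemma3p5 : (N e f : ℕ) → N > 0 → σ** N ≡ 3 * N → 2 ^ e ∥ N → 3 ^ f ∥ N
         → ¬ ((7 ≤ e) × (f ≡ 4))
lemma3p5 N e f N>0 perfect 2^e∥N 3^f∥N (7≤e , refl) = proj₂ 5²∥N 5³∣N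
  where open Lemma3p5 N>0 perfect 2^e∥N 3^f∥N 7≤e
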